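{- Let $m\ge2$ be an integer. Define $sf(n,m)$ for integers $n$ by $sf(n,m)=0$ for $n<0$, $sf(0,m)=1$, and for $n>0$: $sf(n,m)=sf(n/m,m)$ if $n\equiv0\pmod m$, and $sf(n,m)=sf(n-r,m)+sf(n-m,m)$ if $n\equiv r\pmod m$ with $0<r<m$. Then for every integer $j\ge0$, every $v\in\{0,1,\dots,m\}$ and every $r$ with $1\le r\le m-1$, $$sf\bigl(m^j(mv+r),m\bigr)=v+1.$$
   Context: $sf(n,m)$ is the number of semi-$m$-Fibonacci partitions of $n$, characterized by the stated recurrence. -}

module Defs where

open import Data.Nat using (ℕ; zero; suc; _+_; _∸_; _≤?_)
open import Data.Nat.DivMod using (_/_; _%_)
open import Relation.Nullary using (yes; no)

-- Every recursive call strictly decreases n (for m ≥ 2), so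
-- fuel = n + 1 always suffices; see `sf` below.
-- Values sf(k,m) for negative k are 0: a call sf(n-m,m) with n < m is
-- replaced by 0.
-- The modulus m is written as suc (suc k), i.e. m ≥ 2; for m < 2 the
-- function is an arbitrary junk value 0 (never used: the theorem assumes m ≥ 2).
sfFuel : ℕ → ℕ → ℕ → ℕ
sfFuel zero    _               _       = 0
sfFuel (suc f) zero            _       = 0
sfFuel (suc f) (suc zero)      _       = 0
sfFuel (suc f) (suc (suc k))   zero    = 1
sfFuel (suc f) (suc (suc k)) n@(suc _) with n % suc (suc k)
... | zero    = sfFuel f (suc (suc k)) (n / suc (suc k))
... | r@(suc _) = sfFuel f (suc (suc k)) (n ∸ r) + minusM
  where
  minusM : ℕ
  minusM with suc (suc k) ≤? n
  ... | yes _ = sfFuel f (suc (suc k)) (n ∸ suc (suc k))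
  ... | no  _ = 0

sf : ℕ → ℕ → ℕ
sf n m = sfFuel (suc n) m n

-- Multiplying the argument by m leaves sf unchanged, so the factor m^j can be
-- dropped.  For 0 < r < m the recurrence gives
-- sf(m(v+1) + r) = sf(m(v+1)) + sf(mv + r), and sf(mv) = sf(v) = 1 for
-- 1 ≤ v ≤ m (the case v = m via sf(m) = sf(1)), so sf(mv + r) grows by exactly
-- one with each step of v, starting from sf(r) = sf(0) = 1.
module Submission where

open import Defs
open import Data.Nat using (ℕ; zero; suc; _+_; _*_; _∸_; _^_; _≤_; _<_; _≤?_; z≤n; s≤s; NonZero; >-nonZero)
open import Data.Nat.Properties
open import Data.Nat.DivMod using (_/_; _%_; m/n<m; m*n/n≡m; m*n%n≡0; n%n≡0; n/n≡1; m<n⇒m%n≡m; [m+kn]%n≡m%n)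
open import Data.Sum using (inj₁; inj₂)
open import Relation.Binary.PropositionalEquality using (_≡_; refl; trans; cong; cong₂; module ≡-Reasoning)
open import Relation.Nullary using (yes; no; contradiction)

open ≡-Reasoning

m*n%m≡0 : ∀ m n .{{_ : NonZero m}} → m * n % m ≡ 0
m*n%m≡0 m n = trans (cong (_% m) (*-comm m n)) (m*n%n≡0 n m)

m*n/m≡n : ∀ m n .{{_ : NonZero m}} → m * n / m ≡ n
m*n/m≡n m n = trans (cong (_/ m) (*-comm m n)) (m*n/n≡m n m)

[m*n+r]%m≡r : ∀ m n {r} .{{_ : NonZero m}} → r < m → (m * n + r) % m ≡ r
[m*n+r]%m≡r m n {r} r<m = begin
  (m * n + r) % m  ≡⟨ cong (_% m) (trans (+-comm (m * n) r) (cong (r +_) (*-comm m n))) ⟩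
  (r + n * m) % m  ≡⟨ [m+kn]%n≡m%n r n m ⟩
  r % m            ≡⟨ m<n⇒m%n≡m r<m ⟩
  r                ∎

m*[1+n]+r∸m≡m*n+r : ∀ m n r → m * suc n + r ∸ m ≡ m * n + r
m*[1+n]+r∸m≡m*n+r m n r = begin
  m * suc n + r ∸ m    ≡⟨ cong (λ x → x + r ∸ m) (*-suc m n) ⟩
  m + m * n + r ∸ m    ≡⟨ cong (_∸ m) (+-assoc m (m * n) r) ⟩
  m + (m * n + r) ∸ m  ≡⟨ m+n∸m≡n m (m * n + r) ⟩
  m * n + r            ∎

m∸n<o : ∀ {m o} n → m < o → m ∸ n < o
m∸n<o {m} n m<o = ≤-<-trans (m∸n≤m m n) m<o

module _ (k : ℕ) where

  private
    M : ℕ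
    M = suc (suc k)

  -- Every recursive call of sfFuel is on a strictly smaller argument, so any
  -- fuel exceeding the argument gives the same value.
  sfFuel-irrelevant : ∀ f g n → n < f → n < g → sfFuel f M n ≡ sfFuel g M n
  sfFuel-irrelevant (suc f) (suc g) zero _ _ = refl
  sfFuel-irrelevant (suc f) (suc g) n@(suc n-1) (s≤s n≤f) (s≤s n≤g) with n % M
  ... | zero = sfFuel-irrelevant f g (n / M) (<-≤-trans n/M<n n≤f) (<-≤-trans n/M<n n≤g)
    where
    n/M<n : n / M < n
    n/M<n = m/n<m n M (s≤s (s≤s z≤n))
  ... | suc r with M ≤? n
  ...   | yes _ = cong₂ _+_
                    (sfFuel-irrelevant f g (n-1 ∸ r) (m∸n<o r n≤f) (m∸n<o r n≤g))
                    (sfFuel-irrelevant f g (n-1 ∸ suc k) (m∸n<o (suc k) n≤f) (m∸n<o (suc k) n≤g))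
  ...   | no _  = cong (_+ 0) (sfFuel-irrelevant f g (n-1 ∸ r) (m∸n<o r n≤f) (m∸n<o r n≤g))

  sf-divisible : ∀ n .{{_ : NonZero n}} → n % M ≡ 0 → sf n M ≡ sf (n / M) M
  sf-divisible n@(suc n-1) n%M≡0 rewrite n%M≡0 =
    sfFuel-irrelevant n (suc (n / M)) (n / M) (m/n<m n M (s≤s (s≤s z≤n))) ≤-refl

  sf-residue : ∀ n r → M ≤ n → n % M ≡ suc r → sf n M ≡ sf (n ∸ suc r) M + sf (n ∸ M) M
  sf-residue n@(suc n-1) r M≤n n%M≡1+r rewrite n%M≡1+r with M ≤? n
  ... | no M≰n = contradiction M≤n M≰n
  ... | yes _  = cong₂ _+_
    (sfFuel-irrelevant n (suc (n-1 ∸ r)) (n-1 ∸ r) (s≤s (m∸n≤m n-1 r)) ≤-refl)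
    (sfFuel-irrelevant n (suc (n-1 ∸ suc k)) (n-1 ∸ suc k) (s≤s (m∸n≤m n-1 (suc k))) ≤-refl)

  sf-below-modulus : ∀ n .{{_ : NonZero n}} → n < M → sf n M ≡ 1
  sf-below-modulus n@(suc n-1) n<M rewrite m<n⇒m%n≡m n<M with M ≤? n
  ... | yes M≤n = contradiction M≤n (<⇒≱ n<M)
  ... | no _ rewrite n∸n≡0 n-1 = refl

  sf-modulus : sf M M ≡ 1
  sf-modulus = begin
    sf M M        ≡⟨ sf-divisible M (n%n≡0 M) ⟩
    sf (M / M) M  ≡⟨ cong (λ x → sf x M) (n/n≡1 M) ⟩
    sf 1 M        ≡⟨ sf-below-modulus 1 (s≤s (s≤s z≤n)) ⟩
    1             ∎

  sf-*-modulus : ∀ n .{{_ : NonZero n}} → sf (M * n) M ≡ sf n M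
  sf-*-modulus n = begin
    sf (M * n) M      ≡⟨ sf-divisible (M * n) {{m*n≢0 M n}} (m*n%m≡0 M n) ⟩
    sf (M * n / M) M  ≡⟨ cong (λ x → sf x M) (m*n/m≡n M n) ⟩
    sf n M            ∎

  sf-^-modulus : ∀ j n .{{_ : NonZero n}} → sf (M ^ j * n) M ≡ sf n M
  sf-^-modulus zero    n = cong (λ x → sf x M) (*-identityˡ n)
  sf-^-modulus (suc j) n = begin
    sf (M * M ^ j * n) M    ≡⟨ cong (λ x → sf x M) (*-assoc M (M ^ j) n) ⟩
    sf (M * (M ^ j * n)) M  ≡⟨ sf-*-modulus (M ^ j * n) {{m*n≢0 (M ^ j) n {{m^n≢0 M j}}}} ⟩
    sf (M ^ j * n) M        ≡⟨ sf-^-modulus j n ⟩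
    sf n M                  ∎

  sf-*-modulus-bounded : ∀ v → v ≤ M → sf (M * v) M ≡ 1
  sf-*-modulus-bounded zero    _   = cong (λ x → sf x M) (*-zeroʳ M)
  sf-*-modulus-bounded (suc v) v≤M with m≤n⇒m<n∨m≡n v≤M
  ... | inj₁ v<M  = trans (sf-*-modulus (suc v)) (sf-below-modulus (suc v) v<M)
  ... | inj₂ refl = trans (sf-*-modulus M) sf-modulus

  sf-*-modulus-+-residue : ∀ r .{{_ : NonZero r}} → r < M →
                           ∀ v → v ≤ M → sf (M * v + r) M ≡ suc v
  sf-*-modulus-+-residue r r<M zero _ =
    trans (cong (λ x → sf (x + r) M) (*-zeroʳ M)) (sf-below-modulus r r<M)
  sf-*-modulus-+-residue r@(suc r-1) r<M (suc v) 1+v≤M = begin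
    sf (M * suc v + r) M
      ≡⟨ sf-residue (M * suc v + r) r-1 M≤n ([m*n+r]%m≡r M (suc v) r<M) ⟩
    sf (M * suc v + r ∸ r) M + sf (M * suc v + r ∸ M) M
      ≡⟨ cong₂ (λ a b → sf a M + sf b M) (m+n∸n≡m (M * suc v) r) (m*[1+n]+r∸m≡m*n+r M v r) ⟩
    sf (M * suc v) M + sf (M * v + r) M
      ≡⟨ cong₂ _+_ (sf-*-modulus-bounded (suc v) 1+v≤M)
                   (sf-*-modulus-+-residue r r<M v (≤-trans (n≤1+n v) 1+v≤M)) ⟩
    suc (suc v) ∎
    where
    M≤n : M ≤ M * suc v + r
    M≤n = ≤-trans (m≤m*n M (suc v)) (m≤m+n (M * suc v) r)

corollary2 : (m : ℕ) → 2 ≤ m → (j v r : ℕ) → v ≤ m → 1 ≤ r → r ≤ m ∸ 1 →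
    sf (m ^ j * (m * v + r)) m ≡ v + 1
corollary2 (suc (suc k)) _ j v r@(suc _) v≤m _ r≤m-1 = begin
  sf (m ^ j * (m * v + r)) m  ≡⟨ sf-^-modulus k j (m * v + r) {{>-nonZero (≤-trans (s≤s z≤n) (m≤n+m r (m * v)))}} ⟩
  sf (m * v + r) m            ≡⟨ sf-*-modulus-+-residue k r (s≤s r≤m-1) v v≤m ⟩
  suc v                       ≡⟨ +-comm 1 v ⟩
  v + 1                       ∎
  where
  m : ℕ
  m = suc (suc k)
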